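{- Let $(X,A,\rho)$ be a $\mathfrak W$-weighted labelled transition system, $x\in X$, and $\Pi\subseteq\mathrm{FPaths}(x)$. Then there exists a subset $\Pi'\subseteq\Pi$ which is minimal (the cones $\uparrow\pi$, $\pi\in\Pi'$, are pairwise disjoint) and satisfies $\uparrow\Pi=\uparrow\Pi'$, and which is least in the following sense: for any $\Pi''\subseteq\Pi$ with $\uparrow\Pi''=\uparrow\Pi$, for every $\pi''\in\Pi''$ there exists $\pi'\in\Pi'$ with $\pi'\preceq\pi''$. (This $\Pi'$ is denoted $\lfloor\Pi\rfloor$ and called the minimal support of $\Pi$.)
   Context: A $\mathfrak W$-LTS is a triple $(X,A,\rho)$, $X$ a set of states, $A$ an at most countable set of labels, $\rho:X\times A\times X\to W$ with $(W,+,0)$ a commutative monoid. An execution path is a finite or infinite sequence $x_0\xrightarrow{a_1}x_1\xrightarrow{a_2}\cdots$ with all $\rho(x_{i-1},a_i,x_i)\neq 0$; a state is terminal if all its outgoing weights are $0$; a path is complete if infinite or ending in a terminal state. $\mathrm{FPaths}(x)$, $\mathrm{CPaths}(x)$: finite, resp. complete, paths starting at $x$. Prefix preorder: $\pi\preceq\pi'$ iff $\pi$ is finite and $\pi'$ extends it (same states and labels on the first steps), or $\pi=\pi'$. Cone: $\uparrow\pi=\{\pi'\in\mathrm{CPaths}(x)\mid\pi\preceq\pi'\}$; for $\Pi\subseteq\mathrm{FPaths}(x)$, $\uparrow\Pi=\bigcup_{\pi\in\Pi}\uparrow\pi$. -}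

module Defs where

open import Level using (Level; _⊔_) renaming (suc to lsuc)
open import Algebra.Bundles using (CommutativeMonoid)
open import Data.Nat using (ℕ; zero; suc)
open import Data.Unit.Polymorphic using (⊤)
open import Data.Product using (Σ; ∃; _×_; _,_)
open import Data.Sum using (_⊎_)
open import Relation.Nullary using (¬_)
open import Relation.Binary.PropositionalEquality using (_≡_)
open import Function.Definitions using (Injective)

-- A 𝔚-weighted labelled transition system over a commutative monoid W.
-- States X and labels A are types; A is at most countable (injection into ℕ).
record WLTS {c ℓ : Level} (W : CommutativeMonoid c ℓ) : Set (lsuc (c ⊔ ℓ)) where
  open CommutativeMonoid W
  field
    X       : Set
    A       : Set
    enc     : A → ℕ
    enc-inj : Injective _≡_ _≡_ enc
    ρ       : X → A → X → Carrier

module Paths {c ℓ : Level} {W : CommutativeMonoid c ℓ} (L : WLTS W) where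
  open CommutativeMonoid W renaming (ε to 0#)
  open WLTS L

  Step : X → A → X → Set ℓ
  Step x a y = ¬ (ρ x a y ≈ 0#)

  Terminal : X → Set ℓ
  Terminal x = ∀ a y → ρ x a y ≈ 0#

  data FPath (x : X) : Set ℓ where
    []   : FPath x
    step : (a : A) (y : X) → Step x a y → FPath y → FPath x

  last : ∀ {x} → FPath x → X
  last {x} []           = x
  last (step a y s p)   = last p

  record IPath : Set ℓ where
    field
      st    : ℕ → X
      lab   : ℕ → A
      valid : ∀ i → Step (st i) (lab i) (st (suc i))
  open IPath public

  shift : IPath → IPath
  shift π = record { st = λ i → st π (suc i) ; lab = λ i → lab π (suc i)
                   ; valid = λ i → valid π (suc i) }

  CPath : X → Set ℓ
  CPath x = (Σ (FPath x) λ p → Terminal (last p))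
          ⊎ (Σ IPath λ π → st π zero ≡ x)

  -- prefix preorder on finite paths (compares states and labels only)
  data _⪯_ {x : X} : FPath x → FPath x → Set ℓ where
    []⪯   : ∀ {q} → [] ⪯ q
    step⪯ : ∀ {a y s s'} {p q : FPath y} → p ⪯ q → step a y s p ⪯ step a y s' q

  _≈ₚ_ : ∀ {x} → FPath x → FPath x → Set ℓ
  p ≈ₚ q = p ⪯ q × q ⪯ p

  _⪯∞_ : ∀ {x} → FPath x → IPath → Set ℓ
  [] ⪯∞ π             = ⊤
  step a y s p ⪯∞ π   = (lab π zero ≡ a) × (st π (suc zero) ≡ y) × (p ⪯∞ shift π)

  _⪯c_ : ∀ {x} → FPath x → CPath x → Set ℓ
  p ⪯c Data.Sum.inj₁ (q , _) = p ⪯ q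
  p ⪯c Data.Sum.inj₂ (π , _) = p ⪯∞ π

  ↑ : ∀ {x} → FPath x → CPath x → Set ℓ
  ↑ p c = p ⪯c c

  ↑Set : ∀ {x p} → (FPath x → Set p) → CPath x → Set (ℓ ⊔ p)
  ↑Set Π c = ∃ λ π → Π π × π ⪯c c

  _⊆_ : ∀ {x p q} → (FPath x → Set p) → (FPath x → Set q) → Set (ℓ ⊔ p ⊔ q)
  P ⊆ Q = ∀ π → P π → Q π

  SameCone : ∀ {x p q} → (FPath x → Set p) → (FPath x → Set q) → Set (ℓ ⊔ p ⊔ q)
  SameCone {x} P Q = ∀ (c : CPath x) → (↑Set P c → ↑Set Q c) × (↑Set Q c → ↑Set P c)

  Minimal : ∀ {x p} → (FPath x → Set p) → Set (ℓ ⊔ p)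
  Minimal {x} P = ∀ π₁ π₂ → P π₁ → P π₂ → ¬ (π₁ ≈ₚ π₂) →
                  ∀ (c : CPath x) → ¬ (↑ π₁ c × ↑ π₂ c)

module Submission where

-- The minimal support ⌊Π⌋ of a set Π of finite paths is the set of its
-- ⪯-minimal members: those π ∈ Π such that every σ ∈ Π with σ ⪯ π is
-- ⪯-equivalent to π.  The proof has three ingredients.
--   1. An abstract fact about preorders: if the strict part of a transitive,
--      reflexive relation is well founded then, classically, every member of
--      a predicate P lies above some minimal member of P.
--   2. Facts about the prefix order on finite paths: it is a preorder, it is
--      compatible with "prefix of a complete path", a strict prefix is
--      strictly shorter (so strict prefixes are well founded), and two
--      prefixes of the same complete path are comparable.
--   3. The theorem: ⌊Π⌋ ⊆ Π by definition; it is minimal because members with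
--      overlapping cones are comparable, hence equivalent; ↑Π ⊆ ↑⌊Π⌋ and
--      leastness both follow from (1), since every π ∈ Π″ ⊆ Π lies above a
--      minimal member of Π.

open import Defs
open import Level using (Level; _⊔_)
open import Algebra.Bundles using (CommutativeMonoid)
open import Axiom.ExcludedMiddle using (ExcludedMiddle)
open import Data.Product using (Σ; ∃; _×_; _,_; proj₁)
open import Data.Nat using (ℕ; zero; suc; _<_; z≤n; s≤s)
open import Data.Nat.Induction using (<-wellFounded)
open import Data.Sum using (_⊎_; inj₁; inj₂)
open import Data.Unit.Polymorphic using (tt)
open import Induction.WellFounded using (Acc; acc; WellFounded; module Subrelation)
open import Relation.Binary.Core using (Rel)
open import Relation.Binary.Definitions using (Reflexive; Transitive)
open import Relation.Binary.PropositionalEquality using (refl)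
import Relation.Binary.Construct.On as On
open import Relation.Nullary using (¬_; yes; no; contradiction)
open import Relation.Nullary.Decidable using (decidable-stable)

module MinimalElements {a ℓ} {A : Set a} (_≤_ : Rel A ℓ)
         (≤-refl : Reflexive _≤_) (≤-trans : Transitive _≤_)
         (lem : ∀ {b} → ExcludedMiddle b) where

  _≺_ : Rel A ℓ
  σ ≺ π = σ ≤ π × ¬ (π ≤ σ)

  MinimalIn : ∀ {p} → (A → Set p) → A → Set (a ⊔ ℓ ⊔ p)
  MinimalIn P π = P π × (∀ σ → P σ → σ ≤ π → π ≤ σ)

  minimal-below-acc : ∀ {p} (P : A → Set p) π → Acc _≺_ π → P π →
                      ∃ λ σ → MinimalIn P σ × σ ≤ π
  minimal-below-acc P π (acc smaller) Pπ
    with lem {P = ∃ λ σ → P σ × σ ≺ π}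
  ... | yes (σ , Pσ , σ≺π) =
    let (τ , τ-min , τ≤σ) = minimal-below-acc P σ (smaller σ≺π) Pσ
    in τ , τ-min , ≤-trans τ≤σ (proj₁ σ≺π)
  ... | no none-below = π , (Pπ , above) , ≤-refl
    where
    above : ∀ σ → P σ → σ ≤ π → π ≤ σ
    above σ Pσ σ≤π = decidable-stable lem λ π≰σ → none-below (σ , Pσ , σ≤π , π≰σ)

  minimal-below : WellFounded _≺_ → ∀ {p} (P : A → Set p) π → P π →
                  ∃ λ σ → MinimalIn P σ × σ ≤ π
  minimal-below wf P π = minimal-below-acc P π (wf π)

module PrefixOrder {c ℓ : Level} {W : CommutativeMonoid c ℓ} (L : WLTS W) where
  open WLTS L
  open Paths L

  len : ∀ {x} → FPath x → ℕ
  len []             = zero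
  len (step _ _ _ p) = suc (len p)

  ⪯-refl : ∀ {x} {p : FPath x} → p ⪯ p
  ⪯-refl {p = []}           = []⪯
  ⪯-refl {p = step _ _ _ p} = step⪯ ⪯-refl

  ⪯-trans : ∀ {x} {p q r : FPath x} → p ⪯ q → q ⪯ r → p ⪯ r
  ⪯-trans []⪯       _         = []⪯
  ⪯-trans (step⪯ h) (step⪯ k) = step⪯ (⪯-trans h k)

  ⪯-⪯∞-trans : ∀ {x} {p q : FPath x} {ι} → p ⪯ q → q ⪯∞ ι → p ⪯∞ ι
  ⪯-⪯∞-trans []⪯       _                    = tt
  ⪯-⪯∞-trans (step⪯ h) (lab≡ , st≡ , q⪯ι) = lab≡ , st≡ , ⪯-⪯∞-trans h q⪯ι

  ⪯-⪯c-trans : ∀ {x} {p q : FPath x} (γ : CPath x) → p ⪯ q → q ⪯c γ → p ⪯c γ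
  ⪯-⪯c-trans (inj₁ _) = ⪯-trans
  ⪯-⪯c-trans (inj₂ _) = ⪯-⪯∞-trans

  strict-prefix-shorter : ∀ {x} {p q : FPath x} → p ⪯ q → ¬ (q ⪯ p) → len p < len q
  strict-prefix-shorter {q = []}           []⪯ q⋠p = contradiction []⪯ q⋠p
  strict-prefix-shorter {q = step _ _ _ _} []⪯ _   = s≤s z≤n
  strict-prefix-shorter (step⪯ h) q⋠p =
    s≤s (strict-prefix-shorter h λ k → q⋠p (step⪯ k))

  strict-prefix-wellFounded : ∀ {x} →
    WellFounded (λ (p q : FPath x) → p ⪯ q × ¬ (q ⪯ p))
  strict-prefix-wellFounded =
    Subrelation.wellFounded (λ (p⪯q , q⋠p) → strict-prefix-shorter p⪯q q⋠p)
                            (On.wellFounded len <-wellFounded)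

  Comparable : ∀ {x} → FPath x → FPath x → Set ℓ
  Comparable p q = (p ⪯ q) ⊎ (q ⪯ p)

  comparable-⪯ : ∀ {x} {p q r : FPath x} → p ⪯ r → q ⪯ r → Comparable p q
  comparable-⪯ []⪯       _         = inj₁ []⪯
  comparable-⪯ (step⪯ _) []⪯       = inj₂ []⪯
  comparable-⪯ (step⪯ h) (step⪯ k) with comparable-⪯ h k
  ... | inj₁ p⪯q = inj₁ (step⪯ p⪯q)
  ... | inj₂ q⪯p = inj₂ (step⪯ q⪯p)

  comparable-⪯∞ : ∀ {x} (p q : FPath x) ι → p ⪯∞ ι → q ⪯∞ ι → Comparable p q
  comparable-⪯∞ []             _              _ _ _ = inj₁ []⪯
  comparable-⪯∞ (step _ _ _ _) []             _ _ _ = inj₂ []⪯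
  comparable-⪯∞ (step _ _ _ p) (step _ _ _ q) ι (refl , refl , p⪯ι) (refl , refl , q⪯ι)
    with comparable-⪯∞ p q (shift ι) p⪯ι q⪯ι
  ... | inj₁ p⪯q = inj₁ (step⪯ p⪯q)
  ... | inj₂ q⪯p = inj₂ (step⪯ q⪯p)

  comparable-⪯c : ∀ {x} (p q : FPath x) (γ : CPath x) → p ⪯c γ → q ⪯c γ → Comparable p q
  comparable-⪯c p q (inj₁ _)       = comparable-⪯
  comparable-⪯c p q (inj₂ (ι , _)) = comparable-⪯∞ p q ι

lemma3 : (lem : ∀ {a} → ExcludedMiddle a) →
    ∀ {c ℓ p : Level} {W : CommutativeMonoid c ℓ} (L : WLTS W) →
    let open WLTS L
        open Paths L
    in ∀ (x : X) (Π : FPath x → Set p) →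
    Σ (FPath x → Set (ℓ ⊔ p)) λ Π′ →
    (Π′ ⊆ Π) × Minimal Π′ × SameCone Π Π′ ×
    (∀ (Π″ : FPath x → Set p) → Π″ ⊆ Π → SameCone Π″ Π →
    ∀ π″ → Π″ π″ → ∃ λ π′ → Π′ π′ × (π′ ⪯ π″))
lemma3 lem L x Π =
  ⌊Π⌋ , (λ _ → proj₁) , minimal , same-cone , (λ _ Π″⊆Π _ π″ Π″π″ → below (Π″⊆Π π″ Π″π″))
  where
  open Paths L
  open PrefixOrder L
  open MinimalElements (_⪯_ {x}) ⪯-refl ⪯-trans lem

  ⌊Π⌋ : FPath x → Set _
  ⌊Π⌋ = MinimalIn Π

  below : ∀ {π} → Π π → ∃ λ σ → ⌊Π⌋ σ × σ ⪯ π
  below = minimal-below strict-prefix-wellFounded Π _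

  -- members of ⌊Π⌋ with a common complete extension are comparable,
  -- hence equivalent by minimality
  minimal : Minimal ⌊Π⌋
  minimal π₁ π₂ (Ππ₁ , min₁) (Ππ₂ , min₂) π₁≉π₂ γ (π₁⪯γ , π₂⪯γ)
    with comparable-⪯c π₁ π₂ γ π₁⪯γ π₂⪯γ
  ... | inj₁ π₁⪯π₂ = π₁≉π₂ (π₁⪯π₂ , min₂ π₁ Ππ₁ π₁⪯π₂)
  ... | inj₂ π₂⪯π₁ = π₁≉π₂ (min₁ π₂ Ππ₂ π₂⪯π₁ , π₂⪯π₁)

  same-cone : SameCone Π ⌊Π⌋
  same-cone γ = (λ (π , Ππ , π⪯γ) → let (σ , σ-min , σ⪯π) = below Ππ
                                     in σ , σ-min , ⪯-⪯c-trans γ σ⪯π π⪯γ)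
              , (λ (π , (Ππ , _) , π⪯γ) → π , Ππ , π⪯γ)
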